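{- Let $G=(V,E)$ be a directed graph with $V=\{1,\ldots,n\}$ and $uu\in E$ for every $u\in V$. For any $u,v\in V$, \[ \det(\tilde{A}^{v,u}(G))=\sum_{P\in \mathcal{P}_{u,v}} \mu(P)\cdot \det(\tilde{A}(G[V\setminus V(P)])). \]
   Context: Let $X=\{x_{u,v}:u,v\in V\}$ be formal variables over a field $\mathbb{F}$. For a digraph $H$ on a vertex set $W\subseteq V$, the symbolic adjacency matrix $\tilde{A}(H)$ is the $W\times W$ matrix over $\mathbb{F}(X)$ with $\tilde{A}(H)_{a,b}=x_{a,b}$ if $ab\in E(H)$ and $0$ otherwise; the determinant of the empty matrix is $1$. $\tilde{A}^{v,u}(G)$ is obtained from $\tilde{A}(G)$ by zeroing all entries in row $v$ and in column $u$ and then setting the entry $(v,u)$ to $1$. $\mathcal{P}_{u,v}$ denotes the set of all simple directed paths from $u$ to $v$ in $G$ (for $u=v$ this is the single one-vertex path). For a path $P=v_1v_2\ldots v_\ell$, $\mu(P)=\prod_{i=1}^{\ell-1}(-x_{v_i,v_{i+1}})$ (empty product equals $1$), and $V(P)$ is its vertex set. $G[S]$ denotes the subgraph induced by $S$. -}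

module Defs where

open import Level using (Level)
open import Data.Bool using (Bool; true; false; _∧_; _∨_; not; if_then_else_)
open import Data.Nat using (ℕ; zero; suc)
open import Data.Fin using (Fin; _≟_)
open import Data.List using (List; []; _∷_; _++_; [_]; map; concatMap; foldr; filter; length; allFin; upTo)
open import Relation.Nullary.Decidable using (⌊_⌋)
open import Algebra.Bundles using (CommutativeRing)

-- Digraphs on V = Fin n (vertices 0..n-1 stand for 1..n), given by a Boolean
-- adjacency relation: E a b ≡ true  iff  ab is an arc.
Digraph : ℕ → Set
Digraph n = Fin n → Fin n → Bool

module _ {n : ℕ} where

  _==_ : Fin n → Fin n → Bool
  a == b = ⌊ a ≟ b ⌋

  elem : Fin n → List (Fin n) → Bool
  elem a []       = false
  elem a (b ∷ bs) = (a == b) ∨ elem a bs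

  distinct : List (Fin n) → Bool
  distinct []       = true
  distinct (a ∷ as) = not (elem a as) ∧ distinct as

  members : (Fin n → Bool) → List (Fin n)
  members S = filter (λ a → S a Data.Bool.≟ true) (allFin n)

  walkTo : Digraph n → Fin n → List (Fin n) → Bool
  walkTo E v []            = false
  walkTo E v (a ∷ [])      = a == v
  walkTo E v (a ∷ b ∷ ws)  = E a b ∧ walkTo E v (b ∷ ws)

  isSimplePath : Digraph n → Fin n → Fin n → List (Fin n) → Bool
  isSimplePath E u v []       = false
  isSimplePath E u v (a ∷ ws) = (a == u) ∧ walkTo E v (a ∷ ws) ∧ distinct (a ∷ ws)

  allLists : ℕ → List (List (Fin n))
  allLists zero    = [ [] ]
  allLists (suc k) = concatMap (λ i → map (i ∷_) (allLists k)) (allFin n)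

  -- all lists of vertices of length 1..n (every simple path occurs exactly once)
  candidatePaths : List (List (Fin n))
  candidatePaths = concatMap (λ k → allLists (suc k)) (upTo n)

  paths : Digraph n → Fin n → Fin n → List (List (Fin n))
  paths E u v = filter (λ P → isSimplePath E u v P Data.Bool.≟ true) candidatePaths

module WithRing {c ℓ : Level} (R : CommutativeRing c ℓ) where
  open CommutativeRing R

  sgn : ℕ → Carrier
  sgn zero    = 1#
  sgn (suc k) = - sgn k

  sumR : List Carrier → Carrier
  sumR = foldr _+_ 0#

  module _ {n : ℕ} (M : Fin n → Fin n → Carrier) where
    -- determinant of the submatrix with rows rs and columns cs (same length,
    -- in corresponding order), by Laplace expansion along the first row;
    -- the determinant of the empty matrix is 1.
    mutual
      detL : List (Fin n) → List (Fin n) → Carrier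
      detL []       cs = 1#
      detL (r ∷ rs) cs = expand r rs [] cs

      -- Σ over the column c (at position |pre|) of (-1)^|pre| M r c · det(minor)
      expand : Fin n → List (Fin n) → List (Fin n) → List (Fin n) → Carrier
      expand r rs pre []         = 0#
      expand r rs pre (c ∷ post) =
        (sgn (length pre) * M r c) * detL rs (pre ++ post)
          + expand r rs (pre ++ [ c ]) post

  detOn : {n : ℕ} → (Fin n → Fin n → Carrier) → (Fin n → Bool) → Carrier
  detOn M S = detL M (members S) (members S)

  det : {n : ℕ} → (Fin n → Fin n → Carrier) → Carrier
  det M = detOn M (λ _ → true)

  module _ {n : ℕ} (x : Fin n → Fin n → Carrier) (E : Digraph n) where
    -- symbolic adjacency matrix Ã(G) (with variables evaluated at x)
    adjM : Fin n → Fin n → Carrier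
    adjM a b = if E a b then x a b else 0#

    adjM' : Fin n → Fin n → Fin n → Fin n → Carrier
    adjM' v u a b =
      if (a == v) ∧ (b == u) then 1#
      else (if (a == v) ∨ (b == u) then 0# else adjM a b)

    mu : List (Fin n) → Carrier
    mu []           = 1#
    mu (a ∷ [])     = 1#
    mu (a ∷ b ∷ ws) = (- x a b) * mu (b ∷ ws)

    -- det Ã(G[V ∖ V(P)])  (G[S] has arcs of E between vertices of S)
    detAvoid : List (Fin n) → Carrier
    detAvoid P = detOn adjM (λ w → not (elem w P))

    rhs : Fin n → Fin n → Carrier
    rhs u v = sumR (map (λ P → mu P * detAvoid P) (paths E u v))

{-# OPTIONS --safe #-}
module Submission where

-- Both sides satisfy the same first-step recursion. For a set Q of vertices already used by a path
-- from u, a vertex w ∉ Q with u ∈ w ∷ Q, and R = V ∖ (w ∷ Q), consider the bordered minor of Ã^{v,u}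
-- with rows w ∷ R and columns u ∷ R. If w = v its first row is the unit vector at column u, so it
-- equals det Ã(G[R]). Otherwise its entry in column u is 0, and expanding along the first row and then
-- moving row c to the front (the two signs cancel) writes it as Σ_{c ∈ R} (−Ã_{wc}) times the bordered
-- minor for w ∷ Q and c. Splitting off the first arc shows that Σ μ(P) det Ã(G[V ∖ (V(P) ∪ Q)]) over
-- the simple paths P from w to v avoiding Q obeys the same recursion, which terminates as R shrinks.
-- Finally det Ã^{v,u} is the bordered minor for Q = ∅ and w = u, once row and column u are moved to the
-- front.

open import Defs
open import Level using (Level)
open import Data.Bool using (Bool; true; false; _∧_; _∨_; not; if_then_else_)
import Data.Bool as B
open import Data.Bool.Properties
  using (∨-assoc; ∨-identityʳ; ∨-zeroʳ; ∧-assoc; ∧-zeroʳ; ∧-conicalʳ; not-involutive;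
         ∨-commutativeMonoid; ∧-commutativeMonoid)
open import Data.Nat using (ℕ; zero; suc; _≤_; _<_)
open import Data.Nat.Properties using (n<1+n; ≤-reflexive; ≤-trans; <-≤-trans; ≤-pred)
open import Data.Fin as Fin using (Fin; _≟_)
open import Data.Fin.Properties using (suc-injective)
open import Data.List using (List; []; _∷_; _++_; [_]; length; map; concatMap; filter; allFin; upTo)
open import Data.List.Properties
  using (length-filter; length-tabulate; filter-accept; filter-reject; filter-all; filter-≐; length-++-sucʳ; length-++-comm;
         map-∘; map-tabulate; map-upTo; ++-assoc; ++-identityʳ)
open import Data.List.Membership.Propositional using (_∈_)
open import Data.List.Membership.Propositional.Properties using (∈-filter⁺; ∈-filter⁻; ∈-allFin; ∈-∃++; ∈-insert)
open import Data.List.Relation.Unary.All as All using (All; []; _∷_)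
open import Data.List.Relation.Unary.Any using (here; there)
open import Data.List.Relation.Unary.AllPairs using (_∷_)
open import Data.List.Relation.Unary.Unique.Propositional using (Unique)
import Data.List.Relation.Unary.Unique.Propositional.Properties as Unique
open import Data.Product using (_,_; proj₂)
open import Function using (id; _∘_)
open import Algebra.Bundles using (CommutativeMonoid; CommutativeRing)
import Algebra.Properties.CommutativeSemigroup as CommSemigroupProperties
open import Relation.Nullary using (Dec; yes; no)
open import Relation.Nullary.Negation using (contradiction)
open import Relation.Binary.PropositionalEquality as ≡ using (_≡_; _≢_)

-- Vertex lists

private
  module ∨-CS = CommSemigroupProperties (CommutativeMonoid.commutativeSemigroup ∨-commutativeMonoid)
  module ∧-CS = CommSemigroupProperties (CommutativeMonoid.commutativeSemigroup ∧-commutativeMonoid)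

nor-∧-swap : ∀ p q r s → not (p ∨ q) ∧ (not r ∧ s) ≡ not (p ∨ r) ∧ (not q ∧ s)
nor-∧-swap true  q r s = ≡.refl
nor-∧-swap false q r s = ∧-CS.x∙yz≈y∙xz (not q) (not r) s

∈-split : ∀ {a} {A : Set a} {xs : List A} α {c} β → xs ≡ α ++ c ∷ β → c ∈ xs
∈-split α β split = ≡.subst (_ ∈_) (≡.sym split) (∈-insert α)

module _ {n : ℕ} where
  open ≡ using (refl; sym; trans; cong; cong₂; subst; subst₂)
  open ≡.≡-Reasoning

  ==-refl : (a : Fin n) → a == a ≡ true
  ==-refl a with a ≟ a
  ... | yes _   = refl
  ... | no a≢a = contradiction refl a≢a

  ≢⇒==-false : {a b : Fin n} → a ≢ b → a == b ≡ false
  ≢⇒==-false {a} {b} a≢b with a ≟ b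
  ... | yes a≡b = contradiction a≡b a≢b
  ... | no _    = refl

  ==-sym : (a b : Fin n) → a == b ≡ b == a
  ==-sym a b with a ≟ b | b ≟ a
  ... | yes _   | yes _   = refl
  ... | no _    | no _    = refl
  ... | yes a≡b | no b≢a  = contradiction (sym a≡b) b≢a
  ... | no a≢b  | yes b≡a = contradiction (sym b≡a) a≢b

  elem-++ : ∀ (a : Fin n) xs ys → elem a (xs ++ ys) ≡ elem a xs ∨ elem a ys
  elem-++ a []       ys = refl
  elem-++ a (b ∷ xs) ys = trans (cong ((a == b) ∨_) (elem-++ a xs ys)) (sym (∨-assoc (a == b) _ _))

  elem-middle : ∀ (a w : Fin n) xs ys → elem a (xs ++ w ∷ ys) ≡ elem a (w ∷ xs ++ ys)
  elem-middle a w xs ys = begin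
    elem a (xs ++ w ∷ ys)                ≡⟨ elem-++ a xs (w ∷ ys) ⟩
    elem a xs ∨ ((a == w) ∨ elem a ys)   ≡⟨ ∨-CS.x∙yz≈y∙xz (elem a xs) (a == w) (elem a ys) ⟩
    (a == w) ∨ (elem a xs ∨ elem a ys)   ≡⟨ cong ((a == w) ∨_) (elem-++ a xs ys) ⟨
    elem a (w ∷ xs ++ ys)                ∎

  distinct-middle : ∀ (w : Fin n) xs ys → distinct (xs ++ w ∷ ys) ≡ distinct (w ∷ xs ++ ys)
  distinct-middle w []       ys = refl
  distinct-middle w (a ∷ xs) ys = begin
    not (elem a (xs ++ w ∷ ys)) ∧ distinct (xs ++ w ∷ ys)
      ≡⟨ cong₂ (λ p q → not p ∧ q) (elem-middle a w xs ys) (distinct-middle w xs ys) ⟩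
    not ((a == w) ∨ elem a zs) ∧ (not (elem w zs) ∧ distinct zs)
      ≡⟨ cong (λ p → not (p ∨ elem a zs) ∧ (not (elem w zs) ∧ distinct zs)) (==-sym a w) ⟩
    not ((w == a) ∨ elem a zs) ∧ (not (elem w zs) ∧ distinct zs)
      ≡⟨ nor-∧-swap (w == a) (elem a zs) (elem w zs) (distinct zs) ⟩
    not ((w == a) ∨ elem w zs) ∧ (not (elem a zs) ∧ distinct zs)
      ∎
    where zs = xs ++ ys

  walkTo-target : ∀ (E : Digraph n) v xs → walkTo E v xs ≡ true → elem v xs ≡ true
  walkTo-target E v (a ∷ [])     a≡v = trans (∨-identityʳ (v == a)) (trans (==-sym v a) a≡v)
  walkTo-target E v (a ∷ b ∷ xs) walk =
    trans (cong ((v == a) ∨_) (walkTo-target E v (b ∷ xs) (∧-conicalʳ (E a b) _ walk))) (∨-zeroʳ (v == a))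

  keep : (Fin n → Bool) → List (Fin n) → List (Fin n)
  keep S = filter (λ a → S a B.≟ true)

  keep-nor : ∀ (S T : Fin n → Bool) xs →
             keep (λ a → not (S a ∨ T a)) xs ≡ keep (λ a → not (S a)) (keep (λ a → not (T a)) xs)
  keep-nor S T []       = refl
  keep-nor S T (a ∷ xs) with T a
  ... | true  rewrite ∨-zeroʳ (S a) = keep-nor S T xs
  ... | false rewrite ∨-identityʳ (S a) with S a
  ...   | true  = keep-nor S T xs
  ...   | false = cong (a ∷_) (keep-nor S T xs)

  keep-remove : ∀ α (c : Fin n) β → Unique (α ++ c ∷ β) → keep (λ a → not (a == c)) (α ++ c ∷ β) ≡ α ++ β
  keep-remove [] c β (c≢β ∷ _) = begin
    keep (λ a → not (a == c)) (c ∷ β)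
      ≡⟨ filter-reject (λ a → not (a == c) B.≟ true) {c}
                       (λ kept → contradiction (trans (cong not (sym (==-refl c))) kept) λ ()) ⟩
    keep (λ a → not (a == c)) β
      ≡⟨ filter-all (λ a → not (a == c) B.≟ true) (All.map (λ c≢a → cong not (≢⇒==-false (c≢a ∘ sym))) c≢β) ⟩
    β ∎
  keep-remove (a ∷ α) c β (a≢ ∷ unique) = begin
    keep (λ b → not (b == c)) (a ∷ α ++ c ∷ β)
      ≡⟨ filter-accept (λ b → not (b == c) B.≟ true) (cong not (≢⇒==-false (All.lookup a≢ (∈-insert α)))) ⟩
    a ∷ keep (λ b → not (b == c)) (α ++ c ∷ β)
      ≡⟨ cong (a ∷_) (keep-remove α c β unique) ⟩
    a ∷ α ++ β ∎

  avoiding : List (Fin n) → List (Fin n)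
  avoiding Q = members (λ a → not (elem a Q))

  avoiding-unique : ∀ Q → Unique (avoiding Q)
  avoiding-unique Q = Unique.filter⁺ (λ a → not (elem a Q) B.≟ true) (Unique.allFin⁺ n)

  avoiding-cong : ∀ Q Q′ → (∀ a → elem a Q ≡ elem a Q′) → avoiding Q ≡ avoiding Q′
  avoiding-cong Q Q′ same = filter-≐ (λ a → not (elem a Q) B.≟ true) (λ a → not (elem a Q′) B.≟ true)
    ((λ {a} → trans (cong not (sym (same a)))) , (λ {a} → trans (cong not (same a)))) (allFin n)

  avoiding-remove : ∀ Q α c β → avoiding Q ≡ α ++ c ∷ β → avoiding (c ∷ Q) ≡ α ++ β
  avoiding-remove Q α c β split = begin
    avoiding (c ∷ Q)                        ≡⟨ keep-nor (_== c) (λ a → elem a Q) (allFin n) ⟩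
    keep (λ a → not (a == c)) (avoiding Q)  ≡⟨ cong (keep (λ a → not (a == c))) split ⟩
    keep (λ a → not (a == c)) (α ++ c ∷ β)  ≡⟨ keep-remove α c β (subst Unique split (avoiding-unique Q)) ⟩
    α ++ β                                  ∎

  ∈-avoiding⁺ : ∀ Q {c} → elem c Q ≡ false → c ∈ avoiding Q
  ∈-avoiding⁺ Q {c} c∉Q = ∈-filter⁺ (λ a → not (elem a Q) B.≟ true) (∈-allFin c) (cong not c∉Q)

  ∈-avoiding⁻ : ∀ Q {c} → c ∈ avoiding Q → elem c Q ≡ false
  ∈-avoiding⁻ Q {c} c∈ =
    trans (sym (not-involutive _)) (cong not (proj₂ (∈-filter⁻ (λ a → not (elem a Q) B.≟ true) {xs = allFin n} c∈)))

  avoiding-shrinks : ∀ Q {c} → elem c Q ≡ false → length (avoiding (c ∷ Q)) < length (avoiding Q)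
  avoiding-shrinks Q {c} c∉Q with α , β , split ← ∈-∃++ (∈-avoiding⁺ Q c∉Q) =
    subst₂ _<_ (cong length (sym (avoiding-remove Q α c β split)))
               (sym (trans (cong length split) (length-++-sucʳ α c β)))
               (n<1+n _)

  length-avoiding : ∀ Q → length (avoiding Q) ≤ n
  length-avoiding Q =
    ≤-trans (length-filter (λ a → not (elem a Q) B.≟ true) (allFin n)) (≤-reflexive (length-tabulate id))

  elem-head : ∀ (a : Fin n) Q → elem a (a ∷ Q) ≡ true
  elem-head a Q = cong (_∨ elem a Q) (==-refl a)

  ∈-avoiding⇒≢ : ∀ Q {a c} → elem a Q ≡ true → c ∈ avoiding Q → c ≢ a
  ∈-avoiding⇒≢ Q a∈Q c∈ refl = contradiction (trans (sym a∈Q) (∈-avoiding⁻ Q c∈)) λ ()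

module _ {c ℓ : Level} (R : CommutativeRing c ℓ) where
  open CommutativeRing R
  open WithRing R
  open import Algebra.Properties.Ring ring using (-‿distribˡ-*; -‿distribʳ-*; -‿+-comm; -‿involutive; -0#≈0#; -1*x≈-x)
  open import Relation.Binary.Reasoning.Setoid setoid

  private
    module +-CS = CommSemigroupProperties +-commutativeSemigroup
    module *-CS = CommSemigroupProperties *-commutativeSemigroup

  -- Sums over lists

  infixl 10 ∑-syntax
  ∑-syntax : {a : Level} {A : Set a} → List A → (A → Carrier) → Carrier
  ∑-syntax xs f = sumR (map f xs)
  syntax ∑-syntax xs (λ x → e) = ∑[ x ∈ xs ] e

  module _ {a : Level} {A : Set a} where

    ∑-cong : ∀ {f g : A → Carrier} xs → (∀ {x} → x ∈ xs → f x ≈ g x) → ∑[ x ∈ xs ] f x ≈ ∑[ x ∈ xs ] g x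
    ∑-cong []       f≈g = refl
    ∑-cong (x ∷ xs) f≈g = +-cong (f≈g (here ≡.refl)) (∑-cong xs (f≈g ∘ there))

    ∑-zero : ∀ {f : A → Carrier} xs → (∀ {x} → x ∈ xs → f x ≈ 0#) → ∑[ x ∈ xs ] f x ≈ 0#
    ∑-zero []       f≈0 = refl
    ∑-zero (x ∷ xs) f≈0 = trans (+-cong (f≈0 (here ≡.refl)) (∑-zero xs (f≈0 ∘ there))) (+-identityˡ 0#)

    ∑-++ : ∀ (f : A → Carrier) xs ys → ∑[ x ∈ xs ++ ys ] f x ≈ ∑[ x ∈ xs ] f x + ∑[ x ∈ ys ] f x
    ∑-++ f []       ys = sym (+-identityˡ _)
    ∑-++ f (x ∷ xs) ys = trans (+-congˡ (∑-++ f xs ys)) (sym (+-assoc _ _ _))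

    ∑-+ : ∀ (f g : A → Carrier) xs → ∑[ x ∈ xs ] (f x + g x) ≈ ∑[ x ∈ xs ] f x + ∑[ x ∈ xs ] g x
    ∑-+ f g []       = sym (+-identityˡ 0#)
    ∑-+ f g (x ∷ xs) = trans (+-congˡ (∑-+ f g xs)) (+-CS.interchange _ _ _ _)

    ∑-*ˡ : ∀ k (f : A → Carrier) xs → ∑[ x ∈ xs ] (k * f x) ≈ k * ∑[ x ∈ xs ] f x
    ∑-*ˡ k f []       = sym (zeroʳ k)
    ∑-*ˡ k f (x ∷ xs) = trans (+-congˡ (∑-*ˡ k f xs)) (sym (distribˡ k _ _))

    ∑-neg : ∀ (f : A → Carrier) xs → ∑[ x ∈ xs ] (- f x) ≈ - ∑[ x ∈ xs ] f x
    ∑-neg f []       = sym -0#≈0#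
    ∑-neg f (x ∷ xs) = trans (+-congˡ (∑-neg f xs)) (-‿+-comm _ _)

    ∑-filter : ∀ (S : A → Bool) (f : A → Carrier) xs →
               ∑[ x ∈ filter (λ a → S a B.≟ true) xs ] f x ≈ ∑[ x ∈ xs ] (if S x then f x else 0#)
    ∑-filter S f []       = refl
    ∑-filter S f (x ∷ xs) with S x
    ... | true  = +-congˡ (∑-filter S f xs)
    ... | false = trans (∑-filter S f xs) (sym (+-identityˡ _))

  module _ {a b : Level} {A : Set a} {B : Set b} where

    ∑-map : ∀ (f : B → Carrier) (g : A → B) xs → ∑[ y ∈ map g xs ] f y ≡ ∑[ x ∈ xs ] f (g x)
    ∑-map f g xs = ≡.cong sumR (≡.sym (map-∘ xs))

    ∑-concatMap : ∀ (f : B → Carrier) (g : A → List B) xs →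
                  ∑[ y ∈ concatMap g xs ] f y ≈ ∑[ x ∈ xs ] ∑[ y ∈ g x ] f y
    ∑-concatMap f g []       = refl
    ∑-concatMap f g (x ∷ xs) = trans (∑-++ f (g x) (concatMap g xs)) (+-congˡ (∑-concatMap f g xs))

    ∑-comm : ∀ (f : A → B → Carrier) xs ys →
             ∑[ x ∈ xs ] ∑[ y ∈ ys ] f x y ≈ ∑[ y ∈ ys ] ∑[ x ∈ xs ] f x y
    ∑-comm f []       ys = sym (∑-zero ys (λ _ → refl))
    ∑-comm f (x ∷ xs) ys = trans (+-congˡ (∑-comm f xs ys)) (sym (∑-+ (f x) _ ys))

  ∑-upTo-suc : ∀ (f : ℕ → Carrier) m → ∑[ k ∈ upTo (suc m) ] f k ≡ f 0 + ∑[ k ∈ upTo m ] f (suc k)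
  ∑-upTo-suc f m = ≡.cong sumR (≡.trans (map-upTo f (suc m)) (≡.cong (f 0 ∷_) (≡.sym (map-upTo (f ∘ suc) m))))

  ∑-allFin-suc : ∀ {n} (f : Fin (suc n) → Carrier) →
                 ∑[ i ∈ allFin (suc n) ] f i ≡ f Fin.zero + ∑[ i ∈ allFin n ] f (Fin.suc i)
  ∑-allFin-suc f = ≡.cong (λ fs → f Fin.zero + sumR fs)
                          (≡.trans (map-tabulate Fin.suc f) (≡.sym (map-tabulate id (f ∘ Fin.suc))))

  ∑-allFin-single : ∀ {n} (f : Fin n → Carrier) j → (∀ i → i ≢ j → f i ≈ 0#) → ∑[ i ∈ allFin n ] f i ≈ f j
  ∑-allFin-single {suc n} f Fin.zero off = begin
    ∑[ i ∈ allFin (suc n) ] f i                ≡⟨ ∑-allFin-suc f ⟩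
    f Fin.zero + ∑[ i ∈ allFin n ] f (Fin.suc i) ≈⟨ +-congˡ (∑-zero (allFin n) (λ {i} _ → off (Fin.suc i) λ ())) ⟩
    f Fin.zero + 0#                            ≈⟨ +-identityʳ _ ⟩
    f Fin.zero                                 ∎
  ∑-allFin-single {suc n} f (Fin.suc j) off = begin
    ∑[ i ∈ allFin (suc n) ] f i                  ≡⟨ ∑-allFin-suc f ⟩
    f Fin.zero + ∑[ i ∈ allFin n ] f (Fin.suc i)
      ≈⟨ +-cong (off Fin.zero λ ())
                (∑-allFin-single (f ∘ Fin.suc) j (λ i i≢j → off (Fin.suc i) (i≢j ∘ suc-injective))) ⟩
    0# + f (Fin.suc j)                           ≈⟨ +-identityˡ _ ⟩
    f (Fin.suc j)                                ∎

  ∑-avoiding : ∀ {n} {f : Fin n → Carrier} Q → (∀ {c} → elem c Q ≡ true → f c ≈ 0#) →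
               ∑[ c ∈ avoiding Q ] f c ≈ ∑[ c ∈ allFin n ] f c
  ∑-avoiding {n} {f} Q vanish =
    trans (∑-filter (λ a → not (elem a Q)) f (allFin n)) (∑-cong (allFin n) (λ {c} _ → keptOrVanishing c))
    where
    keptOrVanishing : ∀ c → (if not (elem c Q) then f c else 0#) ≈ f c
    keptOrVanishing c with elem c Q in c∈Q
    ... | true  = sym (vanish c∈Q)
    ... | false = refl

  ∑-allLists-suc : ∀ {n} (f : List (Fin n) → Carrier) k →
                   ∑[ L ∈ allLists (suc k) ] f L ≈ ∑[ i ∈ allFin n ] ∑[ L ∈ allLists k ] f (i ∷ L)
  ∑-allLists-suc {n} f k = trans (∑-concatMap f (λ i → map (i ∷_) (allLists k)) (allFin n))
                             (∑-cong (allFin n) (λ {i} _ → reflexive (∑-map f (i ∷_) (allLists k))))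

  module _ {a : Level} {A : Set a} where

    ∑splits : (List A → A → List A → Carrier) → List A → Carrier
    ∑splits f []       = 0#
    ∑splits f (c ∷ cs) = f [] c cs + ∑splits (λ α → f (c ∷ α)) cs

    ∑splits-cong : ∀ {f g} cs → (∀ α c β → cs ≡ α ++ c ∷ β → f α c β ≈ g α c β) →
                   ∑splits f cs ≈ ∑splits g cs
    ∑splits-cong []       f≈g = refl
    ∑splits-cong (c ∷ cs) f≈g =
      +-cong (f≈g [] c cs ≡.refl) (∑splits-cong cs (λ α c′ β split → f≈g (c ∷ α) c′ β (≡.cong (c ∷_) split)))

    ∑splits-zero : ∀ {f} cs → (∀ α c β → cs ≡ α ++ c ∷ β → f α c β ≈ 0#) → ∑splits f cs ≈ 0#
    ∑splits-zero []       f≈0 = refl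
    ∑splits-zero (c ∷ cs) f≈0 = trans (+-cong (f≈0 [] c cs ≡.refl)
      (∑splits-zero cs (λ α c′ β split → f≈0 (c ∷ α) c′ β (≡.cong (c ∷_) split)))) (+-identityˡ 0#)

    ∑splits-neg : ∀ f cs → ∑splits (λ α c β → - f α c β) cs ≈ - ∑splits f cs
    ∑splits-neg f []       = sym -0#≈0#
    ∑splits-neg f (c ∷ cs) = trans (+-congˡ (∑splits-neg (λ α → f (c ∷ α)) cs)) (-‿+-comm _ _)

    ∑splits-middle : ∀ (h : A → Carrier) cs → ∑splits (λ _ c _ → h c) cs ≡ ∑[ c ∈ cs ] h c
    ∑splits-middle h []       = ≡.refl
    ∑splits-middle h (c ∷ cs) = ≡.cong (h c +_) (∑splits-middle h cs)

  -- Determinants by Laplace expansion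

  x-[y-[-z]]≈-[y-[x-z]] : ∀ x y z → x - (y - - z) ≈ - (y - (x - z))
  x-[y-[-z]]≈-[y-[x-z]] x y z = begin
    x - (y - - z)       ≈⟨ +-congˡ (-‿cong (+-congˡ (-‿involutive z))) ⟩
    x - (y + z)         ≈⟨ +-congˡ (-‿+-comm y z) ⟨
    x + (- y + - z)     ≈⟨ +-CS.x∙yz≈y∙xz x (- y) (- z) ⟩
    - y + (x - z)       ≈⟨ +-congˡ (-‿involutive (x - z)) ⟨
    - y + - - (x - z)   ≈⟨ -‿+-comm y (- (x - z)) ⟩
    - (y - (x - z))     ∎

  x[-y]-[-z]≈-[xy-z] : ∀ x y z → x * - y - - z ≈ - (x * y - z)
  x[-y]-[-z]≈-[xy-z] x y z = trans (+-congʳ (sym (-‿distribʳ-* x y))) (-‿+-comm (x * y) (- z))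

  x*-y≈-x*y : ∀ x y → x * - y ≈ - x * y
  x*-y≈-x*y x y = trans (sym (-‿distribʳ-* x y)) (-‿distribˡ-* x y)

  sgn-involutive : ∀ k x → sgn k * (sgn k * x) ≈ x
  sgn-involutive zero    x = trans (*-identityˡ _) (*-identityˡ x)
  sgn-involutive (suc k) x = begin
    - sgn k * (- sgn k * x)    ≈⟨ *-congˡ (-‿distribˡ-* (sgn k) x) ⟨
    - sgn k * - (sgn k * x)    ≈⟨ -‿distribʳ-* (- sgn k) (sgn k * x) ⟨
    - (- sgn k * (sgn k * x))  ≈⟨ -‿cong (-‿distribˡ-* (sgn k) (sgn k * x)) ⟨
    - - (sgn k * (sgn k * x))  ≈⟨ -‿involutive _ ⟩
    sgn k * (sgn k * x)        ≈⟨ sgn-involutive k x ⟩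
    x                          ∎

  module Laplace {n : ℕ} (M : Fin n → Fin n → Carrier) where

    -- rowExpansion r D (c₀ ∷ … ∷ cₖ) = Σⱼ (−1)ʲ · M r cⱼ · D (c₀ … cₖ without cⱼ)
    rowExpansion : Fin n → (List (Fin n) → Carrier) → List (Fin n) → Carrier
    rowExpansion r D []       = 0#
    rowExpansion r D (c ∷ cs) = M r c * D cs - rowExpansion r (λ ys → D (c ∷ ys)) cs

    rowExpansion-cong : ∀ r {D D′} cs → (∀ ys → suc (length ys) ≡ length cs → D ys ≈ D′ ys) →
                        rowExpansion r D cs ≈ rowExpansion r D′ cs
    rowExpansion-cong r []       D≈D′ = refl
    rowExpansion-cong r (c ∷ cs) D≈D′ =
      +-cong (*-congˡ (D≈D′ cs ≡.refl)) (-‿cong (rowExpansion-cong r cs (λ ys len → D≈D′ (c ∷ ys) (≡.cong suc len))))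

    rowExpansion-+ : ∀ r D D′ cs → rowExpansion r (λ ys → D ys + D′ ys) cs ≈ rowExpansion r D cs + rowExpansion r D′ cs
    rowExpansion-+ r D D′ []       = sym (+-identityˡ 0#)
    rowExpansion-+ r D D′ (c ∷ cs) = begin
      M r c * (D cs + D′ cs) - rowExpansion r (λ ys → D (c ∷ ys) + D′ (c ∷ ys)) cs
        ≈⟨ +-cong (distribˡ (M r c) (D cs) (D′ cs)) (-‿cong (rowExpansion-+ r _ _ cs)) ⟩
      (M r c * D cs + M r c * D′ cs) - (rowExpansion r (λ ys → D (c ∷ ys)) cs + rowExpansion r (λ ys → D′ (c ∷ ys)) cs)
        ≈⟨ +-congˡ (-‿+-comm _ _) ⟨
      (M r c * D cs + M r c * D′ cs) + (- rowExpansion r (λ ys → D (c ∷ ys)) cs + - rowExpansion r (λ ys → D′ (c ∷ ys)) cs)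
        ≈⟨ +-CS.interchange _ _ _ _ ⟩
      rowExpansion r D (c ∷ cs) + rowExpansion r D′ (c ∷ cs) ∎

    rowExpansion-*ˡ : ∀ r k D cs → rowExpansion r (λ ys → k * D ys) cs ≈ k * rowExpansion r D cs
    rowExpansion-*ˡ r k D []       = sym (zeroʳ k)
    rowExpansion-*ˡ r k D (c ∷ cs) = begin
      M r c * (k * D cs) - rowExpansion r (λ ys → k * D (c ∷ ys)) cs
        ≈⟨ +-cong (*-CS.x∙yz≈y∙xz (M r c) k (D cs)) (-‿cong (rowExpansion-*ˡ r k _ cs)) ⟩
      k * (M r c * D cs) - k * rowExpansion r (λ ys → D (c ∷ ys)) cs
        ≈⟨ +-congˡ (-‿distribʳ-* k _) ⟩
      k * (M r c * D cs) + k * - rowExpansion r (λ ys → D (c ∷ ys)) cs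
        ≈⟨ distribˡ k _ _ ⟨
      k * rowExpansion r D (c ∷ cs) ∎

    rowExpansion-neg : ∀ r D cs → rowExpansion r (λ ys → - D ys) cs ≈ - rowExpansion r D cs
    rowExpansion-neg r D cs = begin
      rowExpansion r (λ ys → - D ys) cs      ≈⟨ rowExpansion-cong r cs (λ ys _ → -1*x≈-x (D ys)) ⟨
      rowExpansion r (λ ys → - 1# * D ys) cs ≈⟨ rowExpansion-*ˡ r (- 1#) D cs ⟩
      - 1# * rowExpansion r D cs             ≈⟨ -1*x≈-x _ ⟩
      - rowExpansion r D cs                  ∎

    rowExpansion-anticomm : ∀ a b D cs → rowExpansion a (rowExpansion b D) cs ≈ - rowExpansion b (rowExpansion a D) cs
    rowExpansion-anticomm a b D []       = sym -0#≈0#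
    rowExpansion-anticomm a b D (c ∷ cs) = begin
      M a c * rowExpansion b D cs - rowExpansion a (λ ys → M b c * D ys - rowExpansion b D′ ys) cs
        ≈⟨ +-congˡ (-‿cong (expandOuter a b)) ⟩
      M a c * rowExpansion b D cs - (M b c * rowExpansion a D cs - rowExpansion a (rowExpansion b D′) cs)
        ≈⟨ +-congˡ (-‿cong (+-congˡ (-‿cong (rowExpansion-anticomm a b D′ cs)))) ⟩
      M a c * rowExpansion b D cs - (M b c * rowExpansion a D cs - - rowExpansion b (rowExpansion a D′) cs)
        ≈⟨ x-[y-[-z]]≈-[y-[x-z]] _ _ _ ⟩
      - (M b c * rowExpansion a D cs - (M a c * rowExpansion b D cs - rowExpansion b (rowExpansion a D′) cs))
        ≈⟨ -‿cong (+-congˡ (-‿cong (expandOuter b a))) ⟨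
      - (M b c * rowExpansion a D cs - rowExpansion b (λ ys → M a c * D ys - rowExpansion a D′ ys) cs) ∎
      where
      D′ : List (Fin n) → Carrier
      D′ ys = D (c ∷ ys)
      expandOuter : ∀ a b → rowExpansion a (λ ys → M b c * D ys - rowExpansion b D′ ys) cs ≈
                            M b c * rowExpansion a D cs - rowExpansion a (rowExpansion b D′) cs
      expandOuter a b = begin
        rowExpansion a (λ ys → M b c * D ys - rowExpansion b D′ ys) cs
          ≈⟨ rowExpansion-+ a _ _ cs ⟩
        rowExpansion a (λ ys → M b c * D ys) cs + rowExpansion a (λ ys → - rowExpansion b D′ ys) cs
          ≈⟨ +-cong (rowExpansion-*ˡ a _ D cs) (rowExpansion-neg a _ cs) ⟩
        M b c * rowExpansion a D cs - rowExpansion a (rowExpansion b D′) cs ∎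

    expand-rowExpansion : ∀ r rs pre cs →
      expand M r rs pre cs ≈ sgn (length pre) * rowExpansion r (λ ys → detL M rs (pre ++ ys)) cs
    expand-rowExpansion r rs pre []         = sym (zeroʳ _)
    expand-rowExpansion r rs pre (c ∷ post) = begin
      (s * M r c) * detL M rs (pre ++ post) + expand M r rs (pre ++ [ c ]) post
        ≈⟨ +-congˡ (expand-rowExpansion r rs (pre ++ [ c ]) post) ⟩
      (s * M r c) * detL M rs (pre ++ post) + sgn (length (pre ++ [ c ])) * rowExpansion r (λ ys → detL M rs ((pre ++ [ c ]) ++ ys)) post
        ≈⟨ +-congˡ (*-cong (reflexive (≡.cong sgn (length-++-comm pre [ c ])))
                            (rowExpansion-cong r post (λ ys _ → reflexive (≡.cong (detL M rs) (++-assoc pre [ c ] ys))))) ⟩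
      (s * M r c) * detL M rs (pre ++ post) + - s * rowExpansion r (λ ys → detL M rs (pre ++ c ∷ ys)) post
        ≈⟨ +-cong (*-assoc s _ _) (sym (-‿distribˡ-* s _)) ⟩
      s * (M r c * detL M rs (pre ++ post)) + - (s * rowExpansion r (λ ys → detL M rs (pre ++ c ∷ ys)) post)
        ≈⟨ +-congˡ (-‿distribʳ-* s _) ⟩
      s * (M r c * detL M rs (pre ++ post)) + s * - rowExpansion r (λ ys → detL M rs (pre ++ c ∷ ys)) post
        ≈⟨ distribˡ s _ _ ⟨
      s * rowExpansion r (λ ys → detL M rs (pre ++ ys)) (c ∷ post) ∎
      where s = sgn (length pre)

    detL-cons : ∀ r rs cs → detL M (r ∷ rs) cs ≈ rowExpansion r (detL M rs) cs
    detL-cons r rs cs = trans (expand-rowExpansion r rs [] cs) (*-identityˡ _)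

    detL-swap-rows : ∀ a b rs cs → detL M (a ∷ b ∷ rs) cs ≈ - detL M (b ∷ a ∷ rs) cs
    detL-swap-rows a b rs cs = begin
      detL M (a ∷ b ∷ rs) cs                                  ≈⟨ detL-cons a (b ∷ rs) cs ⟩
      rowExpansion a (detL M (b ∷ rs)) cs                     ≈⟨ rowExpansion-cong a cs (λ ys _ → detL-cons b rs ys) ⟩
      rowExpansion a (rowExpansion b (detL M rs)) cs          ≈⟨ rowExpansion-anticomm a b (detL M rs) cs ⟩
      - rowExpansion b (rowExpansion a (detL M rs)) cs        ≈⟨ -‿cong (rowExpansion-cong b cs (λ ys _ → detL-cons a rs ys)) ⟨
      - rowExpansion b (detL M (a ∷ rs)) cs                   ≈⟨ -‿cong (detL-cons b (a ∷ rs) cs) ⟨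
      - detL M (b ∷ a ∷ rs) cs                                ∎

    detL-move-row : ∀ α r β cs → detL M (α ++ r ∷ β) cs ≈ sgn (length α) * detL M (r ∷ α ++ β) cs
    detL-move-row []      r β cs = sym (*-identityˡ _)
    detL-move-row (a ∷ α) r β cs = begin
      detL M (a ∷ α ++ r ∷ β) cs                        ≈⟨ detL-cons a _ cs ⟩
      rowExpansion a (detL M (α ++ r ∷ β)) cs           ≈⟨ rowExpansion-cong a cs (λ ys _ → detL-move-row α r β ys) ⟩
      rowExpansion a (λ ys → s * detL M (r ∷ α ++ β) ys) cs ≈⟨ rowExpansion-*ˡ a s _ cs ⟩
      s * rowExpansion a (detL M (r ∷ α ++ β)) cs       ≈⟨ *-congˡ (detL-cons a _ cs) ⟨
      s * detL M (a ∷ r ∷ α ++ β) cs                    ≈⟨ *-congˡ (detL-swap-rows a r _ cs) ⟩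
      s * - detL M (r ∷ a ∷ α ++ β) cs                  ≈⟨ x*-y≈-x*y s _ ⟩
      - s * detL M (r ∷ a ∷ α ++ β) cs                  ∎
      where s = sgn (length α)

    -- Only lists of length k are constrained: detL M rs is alternating in its columns only when
    -- there are length rs of them.
    Alternating : ℕ → (List (Fin n) → Carrier) → Set ℓ
    Alternating k D = ∀ γ a b δ → suc (suc (length (γ ++ δ))) ≡ k → D (γ ++ a ∷ b ∷ δ) ≈ - D (γ ++ b ∷ a ∷ δ)

    rowExpansion-alternating : ∀ {k} r D → Alternating k D → Alternating (suc k) (rowExpansion r D)
    rowExpansion-alternating r D alt [] a b δ ≡.refl = begin
      M r a * D (b ∷ δ) - (M r b * D (a ∷ δ) - rowExpansion r (λ ys → D (a ∷ b ∷ ys)) δ)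
        ≈⟨ +-congˡ (-‿cong (+-congˡ (-‿cong swapped))) ⟩
      M r a * D (b ∷ δ) - (M r b * D (a ∷ δ) - - rowExpansion r (λ ys → D (b ∷ a ∷ ys)) δ)
        ≈⟨ x-[y-[-z]]≈-[y-[x-z]] _ _ _ ⟩
      - (M r b * D (a ∷ δ) - (M r a * D (b ∷ δ) - rowExpansion r (λ ys → D (b ∷ a ∷ ys)) δ)) ∎
      where
      swapped : rowExpansion r (λ ys → D (a ∷ b ∷ ys)) δ ≈ - rowExpansion r (λ ys → D (b ∷ a ∷ ys)) δ
      swapped = trans (rowExpansion-cong r δ (λ ys len → alt [] a b ys (≡.cong suc len))) (rowExpansion-neg r _ δ)
    rowExpansion-alternating r D alt (g ∷ γ) a b δ ≡.refl = begin
      M r g * D (γ ++ a ∷ b ∷ δ) - rowExpansion r D′ (γ ++ a ∷ b ∷ δ)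
        ≈⟨ +-cong (*-congˡ (alt γ a b δ ≡.refl)) (-‿cong (rowExpansion-alternating r D′ alt′ γ a b δ ≡.refl)) ⟩
      M r g * - D (γ ++ b ∷ a ∷ δ) - - rowExpansion r D′ (γ ++ b ∷ a ∷ δ)
        ≈⟨ x[-y]-[-z]≈-[xy-z] _ _ _ ⟩
      - (M r g * D (γ ++ b ∷ a ∷ δ) - rowExpansion r D′ (γ ++ b ∷ a ∷ δ)) ∎
      where
      D′ : List (Fin n) → Carrier
      D′ ys = D (g ∷ ys)
      alt′ : Alternating (suc (length (γ ++ δ))) D′
      alt′ γ′ a′ b′ δ′ len = alt (g ∷ γ′) a′ b′ δ′ (≡.cong suc len)

    detL-alternating : ∀ rs → Alternating (length rs) (detL M rs)
    detL-alternating []       γ a b δ ()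
    detL-alternating (r ∷ rs) γ a b δ len = begin
      detL M (r ∷ rs) (γ ++ a ∷ b ∷ δ)             ≈⟨ detL-cons r rs (γ ++ a ∷ b ∷ δ) ⟩
      rowExpansion r (detL M rs) (γ ++ a ∷ b ∷ δ)
        ≈⟨ rowExpansion-alternating r (detL M rs) (detL-alternating rs) γ a b δ len ⟩
      - rowExpansion r (detL M rs) (γ ++ b ∷ a ∷ δ) ≈⟨ -‿cong (detL-cons r rs (γ ++ b ∷ a ∷ δ)) ⟨
      - detL M (r ∷ rs) (γ ++ b ∷ a ∷ δ)           ∎

    detL-move-column : ∀ rs γ α c β → suc (length (γ ++ α ++ β)) ≡ length rs →
                       detL M rs (γ ++ α ++ c ∷ β) ≈ sgn (length α) * detL M rs (γ ++ c ∷ α ++ β)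
    detL-move-column rs γ []      c β len = sym (*-identityˡ _)
    detL-move-column rs γ (p ∷ α) c β len = begin
      detL M rs (γ ++ p ∷ α ++ c ∷ β)            ≡⟨ ≡.cong (detL M rs) (++-assoc γ [ p ] _) ⟨
      detL M rs ((γ ++ [ p ]) ++ α ++ c ∷ β)     ≈⟨ detL-move-column rs (γ ++ [ p ]) α c β len′ ⟩
      s * detL M rs ((γ ++ [ p ]) ++ c ∷ α ++ β) ≡⟨ ≡.cong (λ cs → s * detL M rs cs) (++-assoc γ [ p ] _) ⟩
      s * detL M rs (γ ++ p ∷ c ∷ α ++ β)        ≈⟨ *-congˡ (detL-alternating rs γ p c (α ++ β) len″) ⟩
      s * - detL M rs (γ ++ c ∷ p ∷ α ++ β)      ≈⟨ x*-y≈-x*y s _ ⟩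
      - s * detL M rs (γ ++ c ∷ p ∷ α ++ β)      ∎
      where
      s = sgn (length α)
      len′ : suc (length ((γ ++ [ p ]) ++ α ++ β)) ≡ length rs
      len′ = ≡.trans (≡.cong (suc ∘ length) (++-assoc γ [ p ] (α ++ β))) len
      len″ : suc (suc (length (γ ++ α ++ β))) ≡ length rs
      len″ = ≡.trans (≡.cong suc (≡.sym (length-++-sucʳ γ p (α ++ β)))) len

    detL-move-principal : ∀ α c β → detL M (α ++ c ∷ β) (α ++ c ∷ β) ≈ detL M (c ∷ α ++ β) (c ∷ α ++ β)
    detL-move-principal α c β = begin
      detL M (α ++ c ∷ β) (α ++ c ∷ β)             ≈⟨ detL-move-row α c β _ ⟩
      s * detL M (c ∷ α ++ β) (α ++ c ∷ β)         ≈⟨ *-congˡ (detL-move-column (c ∷ α ++ β) [] α c β ≡.refl) ⟩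
      s * (s * detL M (c ∷ α ++ β) (c ∷ α ++ β))   ≈⟨ sgn-involutive (length α) _ ⟩
      detL M (c ∷ α ++ β) (c ∷ α ++ β)             ∎
      where s = sgn (length α)

    rowExpansion-splits : ∀ r D cs → rowExpansion r D cs ≈ ∑splits (λ α c β → M r c * (sgn (length α) * D (α ++ β))) cs
    rowExpansion-splits r D []       = refl
    rowExpansion-splits r D (c ∷ cs) = +-cong (*-congˡ (sym (*-identityˡ (D cs)))) (begin
      - rowExpansion r (λ ys → D (c ∷ ys)) cs
        ≈⟨ -‿cong (rowExpansion-splits r _ cs) ⟩
      - ∑splits (λ α c′ β → M r c′ * (sgn (length α) * D (c ∷ α ++ β))) cs
        ≈⟨ ∑splits-neg _ cs ⟨
      ∑splits (λ α c′ β → - (M r c′ * (sgn (length α) * D (c ∷ α ++ β)))) cs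
        ≈⟨ ∑splits-cong cs (λ α c′ β _ → trans (-‿distribʳ-* _ _) (*-congˡ (-‿distribˡ-* _ _))) ⟩
      ∑splits (λ α c′ β → M r c′ * (- sgn (length α) * D (c ∷ α ++ β))) cs ∎)

    detL-border-expansion : ∀ r c₀ cs →
      detL M (r ∷ cs) (c₀ ∷ cs) ≈
      M r c₀ * detL M cs cs - ∑splits (λ α c β → M r c * detL M (c ∷ α ++ β) (c₀ ∷ α ++ β)) cs
    detL-border-expansion r c₀ cs = begin
      detL M (r ∷ cs) (c₀ ∷ cs)
        ≈⟨ detL-cons r cs (c₀ ∷ cs) ⟩
      M r c₀ * detL M cs cs - rowExpansion r (λ ys → detL M cs (c₀ ∷ ys)) cs
        ≈⟨ +-congˡ (-‿cong (rowExpansion-splits r _ cs)) ⟩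
      M r c₀ * detL M cs cs - ∑splits (λ α c β → M r c * (sgn (length α) * detL M cs (c₀ ∷ α ++ β))) cs
        ≈⟨ +-congˡ (-‿cong (∑splits-cong cs (λ α c β split → *-congˡ (rowToFront α c β split)))) ⟩
      M r c₀ * detL M cs cs - ∑splits (λ α c β → M r c * detL M (c ∷ α ++ β) (c₀ ∷ α ++ β)) cs ∎
      where
      rowToFront : ∀ α c β → cs ≡ α ++ c ∷ β →
                   sgn (length α) * detL M cs (c₀ ∷ α ++ β) ≈ detL M (c ∷ α ++ β) (c₀ ∷ α ++ β)
      rowToFront α c β ≡.refl = trans (*-congˡ (detL-move-row α c β _)) (sgn-involutive (length α) _)

  module _ {n : ℕ} {M N : Fin n → Fin n → Carrier} where
    open Laplace using (rowExpansion; detL-cons)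

    rowExpansion-agree : ∀ {P : Fin n → Set} r {D D′ : List (Fin n) → Carrier} {cs} →
      (∀ {c} → P c → M r c ≈ N r c) → (∀ {ys} → All P ys → D ys ≈ D′ ys) → All P cs →
      rowExpansion M r D cs ≈ rowExpansion N r D′ cs
    rowExpansion-agree r M≈N D≈D′ []         = refl
    rowExpansion-agree r M≈N D≈D′ (pc ∷ pcs) =
      +-cong (*-cong (M≈N pc) (D≈D′ pcs)) (-‿cong (rowExpansion-agree r M≈N (λ pys → D≈D′ (pc ∷ pys)) pcs))

    detL-cong : ∀ {P Q : Fin n → Set} → (∀ {a b} → P a → Q b → M a b ≈ N a b) →
                ∀ {rs cs} → All P rs → All Q cs → detL M rs cs ≈ detL N rs cs
    detL-cong M≈N []                      _   = refl
    detL-cong M≈N {r ∷ rs} {cs} (pr ∷ prs) qcs = begin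
      detL M (r ∷ rs) cs              ≈⟨ detL-cons M r rs cs ⟩
      rowExpansion M r (detL M rs) cs ≈⟨ rowExpansion-agree r (M≈N pr) (λ qys → detL-cong M≈N prs qys) qcs ⟩
      rowExpansion N r (detL N rs) cs ≈⟨ detL-cons N r rs cs ⟨
      detL N (r ∷ rs) cs              ∎

  det-vertex-first : ∀ {n} (M : Fin n → Fin n → Carrier) a → det M ≈ detL M (a ∷ avoiding [ a ]) (a ∷ avoiding [ a ])
  det-vertex-first M a with α , β , split ← ∈-∃++ (∈-avoiding⁺ [] {a} ≡.refl) = begin
    detL M (avoiding []) (avoiding [])          ≡⟨ ≡.cong (λ cs → detL M cs cs) split ⟩
    detL M (α ++ a ∷ β) (α ++ a ∷ β)            ≈⟨ Laplace.detL-move-principal M α a β ⟩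
    detL M (a ∷ α ++ β) (a ∷ α ++ β)
      ≡⟨ ≡.cong (λ cs → detL M (a ∷ cs) (a ∷ cs)) (avoiding-remove [] α a β split) ⟨
    detL M (a ∷ avoiding [ a ]) (a ∷ avoiding [ a ]) ∎

  -- Paths and bordered minors

  module PathExpansion {n : ℕ} (E : Digraph n) (x : Fin n → Fin n → Carrier) (u v : Fin n) where

    A M′ : Fin n → Fin n → Carrier
    A  = adjM x E
    M′ = adjM' x E v u

    adjM'-pivot : M′ v u ≡ 1#
    adjM'-pivot rewrite ==-refl v | ==-refl u = ≡.refl

    adjM'-pivot-row : ∀ {c} → c ≢ u → M′ v c ≡ 0#
    adjM'-pivot-row c≢u rewrite ==-refl v | ≢⇒==-false c≢u = ≡.refl

    adjM'-pivot-column : ∀ {w} → w ≢ v → M′ w u ≡ 0#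
    adjM'-pivot-column w≢v rewrite ≢⇒==-false w≢v | ==-refl u = ≡.refl

    adjM'-elsewhere : ∀ {a b} → a ≢ v → b ≢ u → M′ a b ≡ A a b
    adjM'-elsewhere a≢v b≢u rewrite ≢⇒==-false a≢v | ≢⇒==-false b≢u = ≡.refl

    borderedMinor : List (Fin n) → Fin n → Carrier
    borderedMinor Q w = detL M′ (w ∷ avoiding (w ∷ Q)) (u ∷ avoiding (w ∷ Q))

    borderedMinor-target : ∀ Q {w} → w ≡ v → elem u (w ∷ Q) ≡ true →
                           borderedMinor Q w ≈ detL A (avoiding (w ∷ Q)) (avoiding (w ∷ Q))
    borderedMinor-target Q ≡.refl u∈ = begin
      detL M′ (v ∷ rest) (u ∷ rest)
        ≈⟨ Laplace.detL-border-expansion M′ v u rest ⟩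
      M′ v u * detL M′ rest rest - ∑splits (λ α c β → M′ v c * detL M′ (c ∷ α ++ β) (u ∷ α ++ β)) rest
        ≈⟨ +-cong (*-congʳ (reflexive adjM'-pivot)) (-‿cong (∑splits-zero rest rowVanishes)) ⟩
      1# * detL M′ rest rest - 0#
        ≈⟨ trans (+-cong (*-identityˡ _) -0#≈0#) (+-identityʳ _) ⟩
      detL M′ rest rest
        ≈⟨ detL-cong (λ a≢v b≢u → reflexive (adjM'-elsewhere a≢v b≢u))
                     (All.tabulate (∈-avoiding⇒≢ (v ∷ Q) (elem-head v Q))) (All.tabulate (∈-avoiding⇒≢ (v ∷ Q) u∈)) ⟩
      detL A rest rest ∎
      where
      rest = avoiding (v ∷ Q)
      rowVanishes : ∀ α c β → rest ≡ α ++ c ∷ β → M′ v c * detL M′ (c ∷ α ++ β) (u ∷ α ++ β) ≈ 0#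
      rowVanishes α c β split =
        trans (*-congʳ (reflexive (adjM'-pivot-row (∈-avoiding⇒≢ (v ∷ Q) u∈ (∈-split α β split))))) (zeroˡ _)

    borderedMinor-step : ∀ Q {w} → w ≢ v → elem u (w ∷ Q) ≡ true →
                         borderedMinor Q w ≈ ∑[ c ∈ avoiding (w ∷ Q) ] (- A w c * borderedMinor (w ∷ Q) c)
    borderedMinor-step Q {w} w≢v u∈ = begin
      detL M′ (w ∷ rest) (u ∷ rest)
        ≈⟨ Laplace.detL-border-expansion M′ w u rest ⟩
      M′ w u * detL M′ rest rest - ∑splits (λ α c β → M′ w c * detL M′ (c ∷ α ++ β) (u ∷ α ++ β)) rest
        ≈⟨ +-cong (trans (*-congʳ (reflexive (adjM'-pivot-column w≢v))) (zeroˡ _))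
                  (-‿cong (∑splits-cong rest expandedVertex)) ⟩
      0# - ∑splits (λ _ c _ → A w c * borderedMinor (w ∷ Q) c) rest
        ≈⟨ +-identityˡ _ ⟩
      - ∑splits (λ _ c _ → A w c * borderedMinor (w ∷ Q) c) rest
        ≡⟨ ≡.cong -_ (∑splits-middle (λ c → A w c * borderedMinor (w ∷ Q) c) rest) ⟩
      - ∑[ c ∈ rest ] (A w c * borderedMinor (w ∷ Q) c)
        ≈⟨ ∑-neg (λ c → A w c * borderedMinor (w ∷ Q) c) rest ⟨
      ∑[ c ∈ rest ] (- (A w c * borderedMinor (w ∷ Q) c))
        ≈⟨ ∑-cong rest (λ _ → -‿distribˡ-* _ _) ⟩
      ∑[ c ∈ rest ] (- A w c * borderedMinor (w ∷ Q) c) ∎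
      where
      rest = avoiding (w ∷ Q)
      expandedVertex : ∀ α c β → rest ≡ α ++ c ∷ β →
                       M′ w c * detL M′ (c ∷ α ++ β) (u ∷ α ++ β) ≈ A w c * borderedMinor (w ∷ Q) c
      expandedVertex α c β split = *-cong
        (reflexive (adjM'-elsewhere w≢v (∈-avoiding⇒≢ (w ∷ Q) u∈ (∈-split α β split))))
        (reflexive (≡.cong (λ cs → detL M′ (c ∷ cs) (u ∷ cs)) (≡.sym (avoiding-remove (w ∷ Q) α c β split))))

    simpleTail : List (Fin n) → Fin n → List (Fin n) → Bool
    simpleTail Q w L = walkTo E v (w ∷ L) ∧ distinct (w ∷ L ++ Q)

    pathTerm : List (Fin n) → Fin n → List (Fin n) → Carrier
    pathTerm Q w L =
      if simpleTail Q w L then mu x E (w ∷ L) * detL A (avoiding (w ∷ L ++ Q)) (avoiding (w ∷ L ++ Q)) else 0#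

    pathSum : ℕ → List (Fin n) → Fin n → Carrier
    pathSum k Q w = ∑[ L ∈ allLists k ] pathTerm Q w L

    pathSums : ℕ → List (Fin n) → Fin n → Carrier
    pathSums m Q w = ∑[ k ∈ upTo m ] pathSum k Q w

    simpleTail-cons : ∀ Q w i L → simpleTail Q w (i ∷ L) ≡ E w i ∧ simpleTail (w ∷ Q) i L
    simpleTail-cons Q w i L = ≡.trans (∧-assoc (E w i) _ _)
      (≡.cong (λ d → E w i ∧ (walkTo E v (i ∷ L) ∧ d)) (≡.sym (distinct-middle w (i ∷ L) Q)))

    simpleTail-revisit : ∀ Q w L → elem w (L ++ Q) ≡ true → simpleTail Q w L ≡ false
    simpleTail-revisit Q w L revisit =
      ≡.trans (≡.cong (λ e → walkTo E v (w ∷ L) ∧ (not e ∧ distinct (L ++ Q))) revisit) (∧-zeroʳ _)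

    simpleTail-past-target : ∀ Q i L → simpleTail Q v (i ∷ L) ≡ false
    simpleTail-past-target Q i L with walkTo E v (i ∷ L) in walk
    ... | false = ≡.cong (_∧ distinct (v ∷ i ∷ L ++ Q)) (∧-zeroʳ (E v i))
    ... | true  = ≡.trans (≡.cong (λ b → (E v i ∧ b) ∧ distinct (v ∷ i ∷ L ++ Q)) (≡.sym walk))
                          (simpleTail-revisit Q v (i ∷ L)
                            (≡.trans (elem-++ v (i ∷ L) Q) (≡.cong (_∨ elem v Q) (walkTo-target E v (i ∷ L) walk))))

    pathTerm-vanishes : ∀ Q w L → simpleTail Q w L ≡ false → pathTerm Q w L ≡ 0#
    pathTerm-vanishes Q w L =
      ≡.cong (λ b → if b then mu x E (w ∷ L) * detL A (avoiding (w ∷ L ++ Q)) (avoiding (w ∷ L ++ Q)) else 0#)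

    pathTerm-cons : ∀ Q w i L → pathTerm Q w (i ∷ L) ≈ - A w i * pathTerm (w ∷ Q) i L
    pathTerm-cons Q w i L = begin
      pathTerm Q w (i ∷ L)
        ≡⟨ ≡.cong₂ (λ b P → if b then (- x w i * mu x E (i ∷ L)) * detL A P P else 0#)
                   (simpleTail-cons Q w i L)
                   (avoiding-cong (w ∷ i ∷ L ++ Q) (i ∷ L ++ w ∷ Q) (λ a → ≡.sym (elem-middle a w (i ∷ L) Q))) ⟩
      (if E w i ∧ s then (- x w i * mu x E (i ∷ L)) * d else 0#)
        ≈⟨ guarded (E w i) s ⟩
      - A w i * pathTerm (w ∷ Q) i L ∎
      where
      s = simpleTail (w ∷ Q) i L
      d = detL A (avoiding (i ∷ L ++ w ∷ Q)) (avoiding (i ∷ L ++ w ∷ Q))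
      guarded : ∀ e s′ → (if e ∧ s′ then (- x w i * mu x E (i ∷ L)) * d else 0#) ≈
                         - (if e then x w i else 0#) * (if s′ then mu x E (i ∷ L) * d else 0#)
      guarded false _     = sym (trans (*-congʳ -0#≈0#) (zeroˡ _))
      guarded true  false = sym (zeroʳ _)
      guarded true  true  = *-assoc _ _ _

    pathTerm-at-target : ∀ Q → distinct (v ∷ Q) ≡ true →
                         pathTerm Q v [] ≈ detL A (avoiding (v ∷ Q)) (avoiding (v ∷ Q))
    pathTerm-at-target Q distinct-vQ =
      trans (reflexive (≡.cong (λ b → if b then 1# * detL A (avoiding (v ∷ Q)) (avoiding (v ∷ Q)) else 0#)
                               (≡.cong₂ _∧_ (==-refl v) distinct-vQ)))
            (*-identityˡ _)

    pathSum-suc : ∀ k Q w → pathSum (suc k) Q w ≈ ∑[ i ∈ allFin n ] (- A w i * pathSum k (w ∷ Q) i)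
    pathSum-suc k Q w = trans (∑-allLists-suc (pathTerm Q w) k) (∑-cong (allFin n) λ {i} _ →
      trans (∑-cong (allLists k) (λ {L} _ → pathTerm-cons Q w i L)) (∑-*ˡ (- A w i) (pathTerm (w ∷ Q) i) (allLists k)))

    pathSum-visited : ∀ k Q {w} → elem w Q ≡ true → pathSum k Q w ≈ 0#
    pathSum-visited k Q {w} w∈Q = ∑-zero (allLists k) (λ {L} _ → reflexive (pathTerm-vanishes Q w L
      (simpleTail-revisit Q w L (≡.trans (elem-++ w L Q) (≡.trans (≡.cong (elem w L ∨_) w∈Q) (∨-zeroʳ _))))))

    pathSums-target : ∀ m Q {w} → w ≡ v → distinct (w ∷ Q) ≡ true →
                      pathSums (suc m) Q w ≈ detL A (avoiding (w ∷ Q)) (avoiding (w ∷ Q))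
    pathSums-target m Q ≡.refl distinct-vQ = begin
      pathSums (suc m) Q v                                   ≡⟨ ∑-upTo-suc (λ k → pathSum k Q v) m ⟩
      pathSum 0 Q v + ∑[ k ∈ upTo m ] pathSum (suc k) Q v
        ≈⟨ +-cong (+-identityʳ _) (∑-zero (upTo m) (λ {k} _ → pastTarget k)) ⟩
      pathTerm Q v [] + 0#                                   ≈⟨ +-identityʳ _ ⟩
      pathTerm Q v []                                        ≈⟨ pathTerm-at-target Q distinct-vQ ⟩
      detL A (avoiding (v ∷ Q)) (avoiding (v ∷ Q))           ∎
      where
      pastTarget : ∀ k → pathSum (suc k) Q v ≈ 0#
      pastTarget k = trans (∑-allLists-suc (pathTerm Q v) k) (∑-zero (allFin n) λ {i} _ →
        ∑-zero (allLists k) (λ {L} _ → reflexive (pathTerm-vanishes Q v (i ∷ L) (simpleTail-past-target Q i L))))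

    pathSums-step : ∀ m Q {w} → w ≢ v →
                    pathSums (suc m) Q w ≈ ∑[ c ∈ avoiding (w ∷ Q) ] (- A w c * pathSums m (w ∷ Q) c)
    pathSums-step m Q {w} w≢v = begin
      pathSums (suc m) Q w
        ≡⟨ ∑-upTo-suc (λ k → pathSum k Q w) m ⟩
      pathSum 0 Q w + ∑[ k ∈ upTo m ] pathSum (suc k) Q w
        ≈⟨ +-cong (trans (+-identityʳ _) (reflexive (pathTerm-vanishes Q w [] (≡.cong (_∧ _) (≢⇒==-false w≢v)))))
                  (∑-cong (upTo m) (λ {k} _ → pathSum-suc k Q w)) ⟩
      0# + ∑[ k ∈ upTo m ] ∑[ c ∈ allFin n ] (- A w c * pathSum k (w ∷ Q) c)
        ≈⟨ +-identityˡ _ ⟩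
      ∑[ k ∈ upTo m ] ∑[ c ∈ allFin n ] (- A w c * pathSum k (w ∷ Q) c)
        ≈⟨ ∑-cong (upTo m) (λ {k} _ → ∑-avoiding (w ∷ Q) λ c∈ →
             trans (*-congˡ (pathSum-visited k (w ∷ Q) c∈)) (zeroʳ _)) ⟨
      ∑[ k ∈ upTo m ] ∑[ c ∈ avoiding (w ∷ Q) ] (- A w c * pathSum k (w ∷ Q) c)
        ≈⟨ ∑-comm (λ k c → - A w c * pathSum k (w ∷ Q) c) (upTo m) (avoiding (w ∷ Q)) ⟩
      ∑[ c ∈ avoiding (w ∷ Q) ] ∑[ k ∈ upTo m ] (- A w c * pathSum k (w ∷ Q) c)
        ≈⟨ ∑-cong (avoiding (w ∷ Q)) (λ {c} _ → ∑-*ˡ (- A w c) (λ k → pathSum k (w ∷ Q) c) (upTo m)) ⟩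
      ∑[ c ∈ avoiding (w ∷ Q) ] (- A w c * pathSums m (w ∷ Q) c) ∎

    borderedMinor≈pathSums : ∀ m Q w → distinct (w ∷ Q) ≡ true → elem u (w ∷ Q) ≡ true →
                             length (avoiding (w ∷ Q)) < m → borderedMinor Q w ≈ pathSums m Q w
    borderedMinor≈pathSums (suc m) Q w distinct-wQ u∈ len = byTarget (w ≟ v)
      -- not a with on w ≟ v: it would also abstract the occurrences of w ≟ v inside the entries of M′
      where
      extend : ∀ {c} → c ∈ avoiding (w ∷ Q) → borderedMinor (w ∷ Q) c ≈ pathSums m (w ∷ Q) c
      extend {c} c∈ = borderedMinor≈pathSums m (w ∷ Q) c
        (≡.cong₂ (λ e d → not e ∧ d) (∈-avoiding⁻ (w ∷ Q) c∈) distinct-wQ)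
        (≡.trans (≡.cong ((u == c) ∨_) u∈) (∨-zeroʳ _))
        (<-≤-trans (avoiding-shrinks (w ∷ Q) (∈-avoiding⁻ (w ∷ Q) c∈)) (≤-pred len))
      byTarget : Dec (w ≡ v) → borderedMinor Q w ≈ pathSums (suc m) Q w
      byTarget (yes w≡v) = trans (borderedMinor-target Q w≡v u∈) (sym (pathSums-target m Q w≡v distinct-wQ))
      byTarget (no w≢v)  = begin
        borderedMinor Q w                                             ≈⟨ borderedMinor-step Q w≢v u∈ ⟩
        ∑[ c ∈ avoiding (w ∷ Q) ] (- A w c * borderedMinor (w ∷ Q) c) ≈⟨ ∑-cong (avoiding (w ∷ Q)) (*-congˡ ∘ extend) ⟩
        ∑[ c ∈ avoiding (w ∷ Q) ] (- A w c * pathSums m (w ∷ Q) c)    ≈⟨ pathSums-step m Q w≢v ⟨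
        pathSums (suc m) Q w                                          ∎

    rhs≈pathSums : rhs x E u v ≈ pathSums n [] u
    rhs≈pathSums = begin
      rhs x E u v                                        ≈⟨ ∑-filter (isSimplePath E u v) _ candidatePaths ⟩
      ∑[ P ∈ candidatePaths ] weight P                   ≈⟨ ∑-concatMap weight (λ k → allLists (suc k)) (upTo n) ⟩
      ∑[ k ∈ upTo n ] ∑[ P ∈ allLists (suc k) ] weight P ≈⟨ ∑-cong (upTo n) (λ {k} _ → startingAtU k) ⟩
      pathSums n [] u                                    ∎
      where
      weight : List (Fin n) → Carrier
      weight P = if isSimplePath E u v P then mu x E P * detAvoid x E P else 0#
      startingAtU : ∀ k → ∑[ P ∈ allLists (suc k) ] weight P ≈ pathSum k [] u
      startingAtU k = begin
        ∑[ P ∈ allLists (suc k) ] weight P               ≈⟨ ∑-allLists-suc weight k ⟩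
        ∑[ i ∈ allFin n ] ∑[ L ∈ allLists k ] weight (i ∷ L)
          ≈⟨ ∑-allFin-single _ u (λ i i≢u → ∑-zero (allLists k) (λ _ →
               reflexive (≡.cong (λ b → if b ∧ _ then _ else 0#) (≢⇒==-false i≢u)))) ⟩
        ∑[ L ∈ allLists k ] weight (u ∷ L)               ≈⟨ ∑-cong (allLists k) (λ {L} _ → reflexive (fromU L)) ⟩
        pathSum k [] u                                   ∎
        where
        fromU : ∀ L → weight (u ∷ L) ≡ pathTerm [] u L
        fromU L rewrite ==-refl u | ++-identityʳ L = ≡.refl

mainTheorem6 : {c ℓ : Level} (R : CommutativeRing c ℓ) (n : ℕ)
    (E : Digraph n) → (∀ u → E u u ≡ true) →
    (x : Fin n → Fin n → CommutativeRing.Carrier R) → (u v : Fin n) →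
    CommutativeRing._≈_ R
      (WithRing.det R (WithRing.adjM' R x E v u))
      (WithRing.rhs R x E u v)
mainTheorem6 R n E _ x u v = begin
  det (adjM' x E v u) ≈⟨ det-vertex-first R (adjM' x E v u) u ⟩
  borderedMinor [] u  ≈⟨ borderedMinor≈pathSums n [] u ≡.refl (elem-head u []) rest<n ⟩
  pathSums n [] u     ≈⟨ rhs≈pathSums ⟨
  rhs x E u v         ∎
  where
  open CommutativeRing R
  open WithRing R
  open PathExpansion R E x u v
  open import Relation.Binary.Reasoning.Setoid setoid
  rest<n : length (avoiding [ u ]) < n
  rest<n = <-≤-trans (avoiding-shrinks [] {u} ≡.refl) (length-avoiding [])
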